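{- Let $\mathcal{G}$ be a finite simple graph with vertex set $\mathcal{V}$ having exactly $n$ orbits under its automorphism group. If $\mathcal{A}_1,\mathcal{A}_2\subseteq\mathcal{V}$ are attribute subsets each of which contains elements of $n$ or of $n-1$ distinct orbits, then $\gamma_{\mathcal{A}_1}(\mathcal{G})=\gamma_{\mathcal{A}_2}(\mathcal{G})$.
   Context: Orbits: $\mathcal{O}(y)=\{\pi(y):\pi\in\mathrm{Aut}(\mathcal{G})\}$. For $\mathcal{A}\subseteq\mathcal{V}$, $x\equiv_{\mathcal{A}}y$ iff $\mathcal{O}(x)\cap\mathcal{A}=\mathcal{O}(y)\cap\mathcal{A}$, and $\gamma_{\mathcal{A}}(\mathcal{G})$ is the partition of $\mathcal{V}$ into the equivalence classes of $\equiv_{\mathcal{A}}$. -}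

module Defs where

open import Data.Nat using (ℕ)
open import Data.Fin using (Fin)
open import Data.Bool using (Bool; false)
open import Data.Fin.Subset using (Subset; _∈_)
open import Data.Product using (Σ; _×_; ∃; _,_)
open import Relation.Binary.PropositionalEquality using (_≡_)
open import Relation.Nullary using (¬_)
open import Function.Bundles using (_⇔_)

record SimpleGraph (m : ℕ) : Set where
  field
    Adj    : Fin m → Fin m → Bool
    sym    : ∀ x y → Adj x y ≡ Adj y x
    irrefl : ∀ x → Adj x x ≡ false

open SimpleGraph public

record Automorphism {m : ℕ} (G : SimpleGraph m) : Set where
  field
    fun       : Fin m → Fin m
    inv       : Fin m → Fin m
    inverseˡ  : ∀ x → fun (inv x) ≡ x
    inverseʳ  : ∀ x → inv (fun x) ≡ x
    preserves : ∀ x y → Adj G (fun x) (fun y) ≡ Adj G x y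

open Automorphism public

InOrbit : ∀ {m} (G : SimpleGraph m) → Fin m → Fin m → Set
InOrbit G z y = ∃ λ (π : Automorphism G) → fun π y ≡ z

HasExactlyOrbits : ∀ {m} (G : SimpleGraph m) → ℕ → Set
HasExactlyOrbits {m} G n =
  Σ (Fin n → Fin m) λ r →
    (∀ i j → InOrbit G (r i) (r j) → i ≡ j) ×
    (∀ x → ∃ λ i → InOrbit G x (r i))

MeetsExactlyOrbits : ∀ {m} (G : SimpleGraph m) → Subset m → ℕ → Set
MeetsExactlyOrbits {m} G A k =
  Σ (Fin k → Fin m) λ r →
    (∀ i → r i ∈ A) ×
    (∀ i j → InOrbit G (r i) (r j) → i ≡ j) ×
    (∀ a → a ∈ A → ∃ λ i → InOrbit G a (r i))

EquivAttr : ∀ {m} (G : SimpleGraph m) → Subset m → Fin m → Fin m → Set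
EquivAttr G A x y = ∀ z → (z ∈ A × InOrbit G z x) ⇔ (z ∈ A × InOrbit G z y)

-- γ_A(G) = γ_B(G): the partitions into equivalence classes coincide,
-- i.e. the two equivalence relations coincide.
SamePartition : ∀ {m} (G : SimpleGraph m) → Subset m → Subset m → Set
SamePartition G A B = ∀ x y → EquivAttr G A x y ⇔ EquivAttr G B x y

{-# OPTIONS --safe #-}
module Submission where

-- If A meets all orbits but at most one, then O(x) ∩ A = O(y) ∩ A forces x and y into the
-- same orbit: were the orbits of x and y distinct, A would meet one of them, say in a, and
-- a would then lie in both. Hence γ_A(G) is the orbit partition for every such A.

open import Defs hiding (sym)
open import Data.Nat using (ℕ; suc; _∸_; _≤_; s≤s)
open import Data.Nat.Properties using (≤-refl; m∸n≤m)
open import Data.Fin using (Fin; zero; suc)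
open import Data.Fin.Properties using (_≟_; any?; punchOut-injective; <⇒notInjective)
open import Data.Fin.Subset using (Subset; _∈_)
open import Data.Sum using (_⊎_; inj₁; inj₂)
open import Data.Product using (∃; _×_; _,_; proj₁; proj₂)
open import Data.Empty using (⊥-elim)
open import Function using (_∘_)
open import Function.Bundles using (mk⇔; Equivalence)
open import Function.Definitions using (Injective)
open import Relation.Nullary using (yes; no)
open import Relation.Binary.PropositionalEquality
  using (_≡_; _≢_; refl; sym; trans; cong; cong₂; subst)

injection-hits-one-of : ∀ {k n} {f : Fin k → Fin n} → n ∸ 1 ≤ k → Injective _≡_ _≡_ f →
  ∀ {i j} → i ≢ j → ∃ (λ t → f t ≡ i) ⊎ ∃ (λ t → f t ≡ j)
injection-hits-one-of {k} {suc n} {f} n≤k f-inj {i} {j} i≢j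
  with any? (λ t → f t ≟ i) | any? (λ t → f t ≟ j)
... | yes hit | _       = inj₁ hit
... | no _    | yes hit = inj₂ hit
... | no f≢i  | no f≢j  =
  -- Adjoining i to the image of f and then deleting j would give an injection Fin (suc k) → Fin n.
  ⊥-elim (<⇒notInjective (s≤s n≤k) (λ {s} {t} → g-inj s t ∘ punchOut-injective (j≢g s) (j≢g t)))
  where
  g : Fin (suc k) → Fin (suc n)
  g zero    = i
  g (suc t) = f t
  j≢g : ∀ t → j ≢ g t
  j≢g zero    = i≢j ∘ sym
  j≢g (suc t) = λ j≡ft → f≢j (t , sym j≡ft)
  g-inj : ∀ s t → g s ≡ g t → s ≡ t
  g-inj zero    zero    _ = refl
  g-inj zero    (suc t) e = ⊥-elim (f≢i (t , sym e))
  g-inj (suc s) zero    e = ⊥-elim (f≢i (s , e))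
  g-inj (suc s) (suc t) e = cong suc (f-inj e)

module _ {m : ℕ} {G : SimpleGraph m} where

  inverse : Automorphism G → Automorphism G
  inverse π = record
    { fun = inv π ; inv = fun π
    ; inverseˡ = inverseʳ π ; inverseʳ = inverseˡ π
    ; preserves = λ x y → trans (sym (preserves π (inv π x) (inv π y)))
                                (cong₂ (Adj G) (inverseˡ π x) (inverseˡ π y)) }

  _∘ᴬ_ : Automorphism G → Automorphism G → Automorphism G
  π ∘ᴬ σ = record
    { fun = fun π ∘ fun σ ; inv = inv σ ∘ inv π
    ; inverseˡ = λ x → trans (cong (fun π) (inverseˡ σ (inv π x))) (inverseˡ π x)
    ; inverseʳ = λ x → trans (cong (inv σ) (inverseʳ π (fun σ x))) (inverseʳ σ x)
    ; preserves = λ x y → trans (preserves π (fun σ x) (fun σ y)) (preserves σ x y) }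

  inOrbit-sym : ∀ {x y} → InOrbit G x y → InOrbit G y x
  inOrbit-sym {x} {y} (π , πy≡x) = inverse π , trans (cong (inv π) (sym πy≡x)) (inverseʳ π y)

  inOrbit-trans : ∀ {x y z} → InOrbit G x y → InOrbit G y z → InOrbit G x z
  inOrbit-trans (π , πy≡x) (σ , σz≡y) = π ∘ᴬ σ , trans (cong (fun π) σz≡y) πy≡x

  inOrbit⇒equivAttr : ∀ A {x y} → InOrbit G x y → EquivAttr G A x y
  inOrbit⇒equivAttr A x∼y z = mk⇔ (λ (z∈A , z∼x) → z∈A , inOrbit-trans z∼x x∼y)
                                   (λ (z∈A , z∼y) → z∈A , inOrbit-trans z∼y (inOrbit-sym x∼y))

  MeetsOrbitOf : Subset m → Fin m → Set
  MeetsOrbitOf A x = ∃ λ a → a ∈ A × InOrbit G a x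

  equivAttr-meets⇒inOrbit : ∀ {A x y} → EquivAttr G A x y → MeetsOrbitOf A x → InOrbit G x y
  equivAttr-meets⇒inOrbit x≡ᴬy (a , a∈A , a∼x) =
    inOrbit-trans (inOrbit-sym a∼x) (proj₂ (Equivalence.to (x≡ᴬy a) (a∈A , a∼x)))

  equivAttr-sym : ∀ {A x y} → EquivAttr G A x y → EquivAttr G A y x
  equivAttr-sym x≡ᴬy z = mk⇔ (Equivalence.from (x≡ᴬy z)) (Equivalence.to (x≡ᴬy z))

  module _ {n : ℕ} (orbits : HasExactlyOrbits G n) where

    private
      representative : Fin n → Fin m
      representative = proj₁ orbits

    orbitIndex : Fin m → Fin n
    orbitIndex x = proj₁ (proj₂ (proj₂ orbits) x)

    sameOrbitIndex⇒inOrbit : ∀ {x y} → orbitIndex x ≡ orbitIndex y → InOrbit G x y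
    sameOrbitIndex⇒inOrbit {x} {y} i≡j = inOrbit-trans x∼rᵢ (inOrbit-sym y∼rᵢ)
      where
      x∼rᵢ : InOrbit G x (representative (orbitIndex x))
      x∼rᵢ = proj₂ (proj₂ (proj₂ orbits) x)
      y∼rᵢ : InOrbit G y (representative (orbitIndex x))
      y∼rᵢ = subst (InOrbit G y ∘ representative) (sym i≡j) (proj₂ (proj₂ (proj₂ orbits) y))

    inOrbit-or-meets : ∀ {A k} → n ∸ 1 ≤ k → MeetsExactlyOrbits G A k →
      ∀ x y → InOrbit G x y ⊎ MeetsOrbitOf A x ⊎ MeetsOrbitOf A y
    inOrbit-or-meets n∸1≤k (r , r∈A , r-distinct , _) x y
      with orbitIndex x ≟ orbitIndex y
    ... | yes i≡j = inj₁ (sameOrbitIndex⇒inOrbit i≡j)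
    ... | no  i≢j with injection-hits-one-of n∸1≤k (r-distinct _ _ ∘ sameOrbitIndex⇒inOrbit) i≢j
    ...   | inj₁ (t , e) = inj₂ (inj₁ (r t , r∈A t , sameOrbitIndex⇒inOrbit e))
    ...   | inj₂ (t , e) = inj₂ (inj₂ (r t , r∈A t , sameOrbitIndex⇒inOrbit e))

    equivAttr⇒inOrbit : ∀ {A k} → n ∸ 1 ≤ k → MeetsExactlyOrbits G A k →
      ∀ {x y} → EquivAttr G A x y → InOrbit G x y
    equivAttr⇒inOrbit n∸1≤k meets {x} {y} x≡ᴬy with inOrbit-or-meets n∸1≤k meets x y
    ... | inj₁ x∼y        = x∼y
    ... | inj₂ (inj₁ A∩x) = equivAttr-meets⇒inOrbit x≡ᴬy A∩x
    ... | inj₂ (inj₂ A∩y) = inOrbit-sym (equivAttr-meets⇒inOrbit (equivAttr-sym x≡ᴬy) A∩y)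

proposition1p0p5 : ∀ {m : ℕ} (G : SimpleGraph m) (n : ℕ) → HasExactlyOrbits G n →
    (A₁ A₂ : Subset m) →
    (MeetsExactlyOrbits G A₁ n ⊎ MeetsExactlyOrbits G A₁ (n ∸ 1)) →
    (MeetsExactlyOrbits G A₂ n ⊎ MeetsExactlyOrbits G A₂ (n ∸ 1)) →
    SamePartition G A₁ A₂
proposition1p0p5 G n orbits A₁ A₂ meets₁ meets₂ x y =
  mk⇔ (inOrbit⇒equivAttr A₂ ∘ equivAttr⇒inOrbit′ meets₁)
      (inOrbit⇒equivAttr A₁ ∘ equivAttr⇒inOrbit′ meets₂)
  where
  equivAttr⇒inOrbit′ : ∀ {A} → MeetsExactlyOrbits G A n ⊎ MeetsExactlyOrbits G A (n ∸ 1) →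
    EquivAttr G A x y → InOrbit G x y
  equivAttr⇒inOrbit′ (inj₁ meets) = equivAttr⇒inOrbit orbits (m∸n≤m n 1) meets
  equivAttr⇒inOrbit′ (inj₂ meets) = equivAttr⇒inOrbit orbits ≤-refl meets
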